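{- Let $T$ be a tree of order $n\geq 3$. If every vertex of $T$ is a leaf or a support vertex, then $\chi_d^t(T)=s+1$, where $s$ is the number of support vertices of $T$.
   Context: In a tree, a leaf is a vertex of degree one, and a support vertex is a neighbor of a leaf that has degree more than one. A total dominator coloring of a graph $G$ is a proper vertex coloring of $G$ in which each vertex of $G$ is adjacent to every vertex of some color class; $\chi_d^t(G)$ is the minimum number of color classes in a total dominator coloring of $G$. -}

module Defs where

open import Data.Nat using (ℕ; zero; suc; _<_; _≤_; _≥_)
open import Data.Fin using (Fin)
open import Data.Bool using (Bool; true; false; T)
open import Data.List using (List; []; _∷_; _++_; [_]; length; filter)
open import Data.Bool.ListAction using (any)
open import Data.Nat using (_≡ᵇ_; _<ᵇ_)
open import Data.List.Relation.Unary.Linked using (Linked)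
open import Data.List.Relation.Unary.Unique.Propositional using (Unique)
open import Data.Product using (Σ; _×_; ∃)
open import Relation.Binary.PropositionalEquality using (_≡_; _≢_)
open import Relation.Nullary using (¬_)
open import Data.List using (allFin)
open import Data.Bool using (_∧_)

record Graph (n : ℕ) : Set where
  field
    adj   : Fin n → Fin n → Bool
    sym   : ∀ u v → adj u v ≡ adj v u
    irrefl : ∀ v → adj v v ≡ false

module _ {n : ℕ} (G : Graph n) where
  open Graph G

  Adj : Fin n → Fin n → Set
  Adj u v = T (adj u v)

  data Reachable : Fin n → Fin n → Set where
    here  : ∀ {v} → Reachable v v
    step  : ∀ {u v w} → Adj u v → Reachable v w → Reachable u w

  Connected : Set
  Connected = ∀ u v → Reachable u v

  -- a cycle: distinct vertices v, u₁, …, u_k, w (k ≥ 1, so ≥ 3 vertices),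
  -- consecutive ones adjacent, and w adjacent to v
  HasCycle : Set
  HasCycle = Σ (Fin n) λ v → Σ (List (Fin n)) λ us → Σ (Fin n) λ w →
    (1 ≤ length us) × Unique (v ∷ us ++ [ w ]) × Linked Adj (v ∷ us ++ [ w ]) × Adj w v

  Acyclic : Set
  Acyclic = ¬ HasCycle

  IsTree : Set
  IsTree = Connected × Acyclic

  degree : Fin n → ℕ
  degree v = length (filter (λ u → T? (adj v u)) (allFin n))
    where
    open import Relation.Nullary.Decidable using (Dec; yes; no)
    T? : (b : Bool) → Dec (T b)
    T? true = yes _
    T? false = no λ ()

  isLeaf : Fin n → Bool
  isLeaf v = degree v ≡ᵇ 1

  isSupport : Fin n → Bool
  isSupport v = any (λ u → adj v u ∧ isLeaf u) (allFin n) ∧ (1 <ᵇ degree v)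

  numSupport : ℕ
  numSupport = length (filter (λ v → T? (isSupport v)) (allFin n))
    where
    open import Relation.Nullary.Decidable using (Dec; yes; no)
    T? : (b : Bool) → Dec (T b)
    T? true = yes _
    T? false = no λ ()

  Proper : {k : ℕ} → (Fin n → Fin k) → Set
  Proper c = ∀ u v → Adj u v → c u ≢ c v

  TotallyDominating : {k : ℕ} → (Fin n → Fin k) → Set
  TotallyDominating {k} c = ∀ v → Σ (Fin k) λ i →
    (Σ (Fin n) λ x → c x ≡ i) × (∀ u → c u ≡ i → Adj v u)

  IsTDC : {k : ℕ} → (Fin n → Fin k) → Set
  IsTDC c = Proper c × TotallyDominating c

  HasTDC : ℕ → Set
  HasTDC k = Σ (Fin n → Fin k) IsTDC

  TDChromaticNumber≡ : ℕ → Set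
  TDChromaticNumber≡ m = HasTDC m × (∀ k → k < m → ¬ HasTDC k)

-- A leaf ℓ of a total dominator colouring dominates some colour class, and ℓ has a
-- single neighbour x, so that class is {x}: every support vertex is alone in its
-- colour class. A leaf is not a support vertex, so at least s + 1 colours are needed.
-- Conversely, colour each support vertex with its own colour and all leaves with one
-- more. In a connected graph on at least three vertices no two leaves are adjacent, so
-- this is proper; a leaf dominates the class of its (support) neighbour, and a support
-- vertex either has a support neighbour or, all its neighbours being leaves, is adjacent
-- to every other vertex, hence to the whole class of leaves.

module Submission where

open import Defs
open import Data.Bool using (T)
open import Data.Bool.Properties using (T-∧; T-irrelevant)
open import Data.Empty using (⊥-elim)
open import Data.Fin using (Fin; zero; suc; fromℕ<)
open import Data.Fin.Properties using (any?; injective⇒≤; suc-injective)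
open import Data.List using (List; []; _∷_; length; lookup; filter; allFin)
open import Data.List.Membership.Propositional using (_∈_)
open import Data.List.Membership.Propositional.Properties using (∈-filter⁺; ∈-filter⁻; ∈-allFin; ∈-lookup)
open import Data.List.Membership.Setoid.Properties using (index-injective)
open import Data.List.Properties using (filter-≐)
open import Data.List.Relation.Unary.All as All using ()
open import Data.List.Relation.Unary.Any using (here; index; satisfied)
open import Data.List.Relation.Unary.Any.Properties using (any⁻)
open import Data.List.Relation.Unary.AllPairs using (_∷_)
open import Data.List.Relation.Unary.Unique.Propositional using (Unique)
open import Data.List.Relation.Unary.Unique.Propositional.Properties using (allFin⁺; filter⁺)
open import Data.Nat using (ℕ; suc; _≤_; _<_; _≥_)
open import Data.Nat.Properties using (≡ᵇ⇒≡; <ᵇ⇒<; <-irrefl; <⇒≱)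
open import Data.Product using (∃; _×_; _,_; proj₁; proj₂)
open import Data.Sum using (_⊎_; inj₁; inj₂; [_,_])
open import Function using (_∘_; id; Equivalence)
open import Level using (Level; 0ℓ)
open import Relation.Binary.PropositionalEquality using (_≡_; refl; sym; trans; cong; subst; setoid)
open import Relation.Nullary using (¬_; yes; no; contradiction; _×-dec_)
open import Relation.Nullary.Decidable using (T?)
open import Relation.Unary using (Pred; Decidable)

private
  variable
    a p : Level
    A : Set a
    n : ℕ

lookup-injective : {xs : List A} → Unique xs → ∀ i j → lookup xs i ≡ lookup xs j → i ≡ j
lookup-injective (_ ∷ _)      zero    zero    _  = refl
lookup-injective (x∉xs ∷ _)   zero    (suc j) eq = contradiction eq (All.lookup x∉xs (∈-lookup j))
lookup-injective (x∉xs ∷ _)   (suc i) zero    eq = contradiction (sym eq) (All.lookup x∉xs (∈-lookup i))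
lookup-injective (_ ∷ unique) (suc i) (suc j) eq = cong suc (lookup-injective unique i j eq)

length≡1⇒∈-unique : {xs : List A} {x y : A} → length xs ≡ 1 → x ∈ xs → y ∈ xs → x ≡ y
length≡1⇒∈-unique {xs = _ ∷ []} _ (here refl) (here refl) = refl

length≡1⇒nonempty : {xs : List A} → length xs ≡ 1 → ∃ (_∈ xs)
length≡1⇒nonempty {xs = x ∷ []} _ = x , here refl

covered-by-two⇒≤2 : {a b : Fin n} → (∀ w → w ≡ a ⊎ w ≡ b) → n ≤ 2
covered-by-two⇒≤2 {n} cover = injective⇒≤ {f = side} side-injective
  where
  side : Fin n → Fin 2
  side w = [ (λ _ → zero) , (λ _ → suc zero) ] (cover w)

  side-injective : ∀ {v w} → side v ≡ side w → v ≡ w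
  side-injective {v} {w} eq with cover v | cover w
  ... | inj₁ refl | inj₁ refl = refl
  ... | inj₂ refl | inj₂ refl = refl
  side-injective () | inj₁ _ | inj₂ _
  side-injective () | inj₂ _ | inj₁ _

module Enumeration {P : Pred (Fin n) p} (P? : Decidable P) where

  members : List (Fin n)
  members = filter P? (allFin n)

  rank : ∀ {x} → P x → Fin (length members)
  rank {x} px = index (∈-filter⁺ P? (∈-allFin x) px)

  rank-injective : ∀ {x y} (px : P x) (py : P y) → rank px ≡ rank py → x ≡ y
  rank-injective {x} {y} px py =
    index-injective (setoid (Fin n)) (∈-filter⁺ P? (∈-allFin x) px) (∈-filter⁺ P? (∈-allFin y) py)

  unrank : Fin (length members) → Fin n
  unrank = lookup members

  unrank-satisfies : ∀ i → P (unrank i)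
  unrank-satisfies i = proj₂ (∈-filter⁻ P? {xs = allFin n} (∈-lookup i))

  unrank-injective : ∀ i j → unrank i ≡ unrank j → i ≡ j
  unrank-injective = lookup-injective (filter⁺ P? (allFin⁺ n))

module _ (G : Graph n) where
  open Graph G using (adj)

  Leaf Support : Pred (Fin n) 0ℓ
  Leaf v = T (isLeaf G v)
  Support v = T (isSupport G v)

  Adj-sym : ∀ {u v} → Adj G u v → Adj G v u
  Adj-sym {u} {v} = subst T (Graph.sym G u v)

  Adj-irrefl : ∀ {v} → ¬ Adj G v v
  Adj-irrefl {v} = subst T (Graph.irrefl G v)

  neighbours : Fin n → List (Fin n)
  neighbours v = filter (T? ∘ adj v) (allFin n)

  degree≡length-neighbours : ∀ v → degree G v ≡ length (neighbours v)
  degree≡length-neighbours v = cong length (filter-≐ _ (T? ∘ adj v) (id , id) (allFin n))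

  Adj⇒∈-neighbours : ∀ {v u} → Adj G v u → u ∈ neighbours v
  Adj⇒∈-neighbours {v} {u} = ∈-filter⁺ (T? ∘ adj v) (∈-allFin u)

  leaf⇒degree≡1 : ∀ {v} → Leaf v → length (neighbours v) ≡ 1
  leaf⇒degree≡1 {v} leaf = trans (sym (degree≡length-neighbours v)) (≡ᵇ⇒≡ _ 1 leaf)

  leaf-neighbour : ∀ {v} → Leaf v → ∃ (Adj G v)
  leaf-neighbour {v} leaf with length≡1⇒nonempty (leaf⇒degree≡1 leaf)
  ... | u , u∈ = u , proj₂ (∈-filter⁻ (T? ∘ adj v) {xs = allFin n} u∈)

  leaf-neighbour-unique : ∀ {v u w} → Leaf v → Adj G v u → Adj G v w → u ≡ w
  leaf-neighbour-unique leaf vu vw =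
    length≡1⇒∈-unique (leaf⇒degree≡1 leaf) (Adj⇒∈-neighbours vu) (Adj⇒∈-neighbours vw)

  support⇒leaf-neighbour : ∀ {v} → Support v → ∃ λ u → Adj G v u × Leaf u
  support⇒leaf-neighbour {v} support
    with satisfied (any⁻ _ (allFin n) (proj₁ (Equivalence.to T-∧ support)))
  ... | u , vu∧leaf = u , Equivalence.to T-∧ vu∧leaf

  leaf⇒¬support : ∀ {v} → Leaf v → ¬ Support v
  leaf⇒¬support {v} leaf support = <-irrefl (sym (≡ᵇ⇒≡ _ 1 leaf)) 1<degree
    where
    1<degree : 1 < degree G v
    1<degree = <ᵇ⇒< 1 (degree G v) (proj₂ (Equivalence.to T-∧ support))

  adjacent-leaves-span : ∀ {a b y} → Leaf a → Leaf b → Adj G a b →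
                         Reachable G a y → y ≡ a ⊎ y ≡ b
  adjacent-leaves-span {a} {b} leaf-a leaf-b ab = walk (inj₁ refl)
    where
    walk : ∀ {x y} → x ≡ a ⊎ x ≡ b → Reachable G x y → y ≡ a ⊎ y ≡ b
    walk x∈ab        here            = x∈ab
    walk (inj₁ refl) (step az reach) = walk (inj₂ (leaf-neighbour-unique leaf-a az ab)) reach
    walk (inj₂ refl) (step bz reach) = walk (inj₁ (leaf-neighbour-unique leaf-b bz (Adj-sym ab))) reach

  leaf-neighbourhood-span : ∀ {v y} → (∀ {z} → Adj G v z → Leaf z) →
                            Reachable G v y → y ≡ v ⊎ Adj G v y
  leaf-neighbourhood-span {v} neighbours-leaves = fromCentre
    where
    mutual
      fromCentre : ∀ {y} → Reachable G v y → y ≡ v ⊎ Adj G v y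
      fromCentre here            = inj₁ refl
      fromCentre (step vz reach) = fromNeighbour vz reach

      fromNeighbour : ∀ {z y} → Adj G v z → Reachable G z y → y ≡ v ⊎ Adj G v y
      fromNeighbour vz here = inj₂ vz
      fromNeighbour vz (step zw reach) with leaf-neighbour-unique (neighbours-leaves vz) zw (Adj-sym vz)
      ... | refl = fromCentre reach

  support-colour-class-singleton : ∀ {k} {c : Fin n → Fin k} {x y} →
    TotallyDominating G c → Support x → c y ≡ c x → y ≡ x
  support-colour-class-singleton {c = c} {x} {y} dominating support cy≡cx
    with support⇒leaf-neighbour support
  ... | ℓ , xℓ , leaf with dominating ℓ
  ... | i , (z , cz≡i) , ℓ-dominates-i =
    leaf-neighbour-unique leaf (ℓ-dominates-i y (trans cy≡cx cx≡i)) (Adj-sym xℓ)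
    where
    cx≡i : c x ≡ i
    cx≡i = subst (λ w → c w ≡ i) (leaf-neighbour-unique leaf (ℓ-dominates-i z cz≡i) (Adj-sym xℓ)) cz≡i

  open Enumeration {P = Support} (T? ∘ isSupport G)
    renaming (members to supports; unrank to nth-support; unrank-satisfies to support-satisfies;
              unrank-injective to support-injective)

  numSupport≡length-supports : numSupport G ≡ length supports
  numSupport≡length-supports = cong length (filter-≐ _ (T? ∘ isSupport G) (id , id) (allFin n))

  1+numSupport≤colours : ∀ {k ℓ} → Leaf ℓ → HasTDC G k → suc (numSupport G) ≤ k
  1+numSupport≤colours {k} {ℓ} leaf (c , _ , dominating) =
    subst (λ s → suc s ≤ k) (sym numSupport≡length-supports) (injective⇒≤ {f = c ∘ g} c∘g-injective)
    where
    own-colour : ∀ {x y} → Support x → c y ≡ c x → y ≡ x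
    own-colour = support-colour-class-singleton dominating

    g : Fin (suc (length supports)) → Fin n
    g zero    = ℓ
    g (suc i) = nth-support i

    g-injective : ∀ {i j} → g i ≡ g j → i ≡ j
    g-injective {zero}  {zero}  _  = refl
    g-injective {zero}  {suc j} eq = ⊥-elim (leaf⇒¬support leaf (subst Support (sym eq) (support-satisfies j)))
    g-injective {suc i} {zero}  eq = ⊥-elim (leaf⇒¬support leaf (subst Support eq (support-satisfies i)))
    g-injective {suc i} {suc j} eq = cong suc (support-injective i j eq)

    c∘g-injective : ∀ {i j} → c (g i) ≡ c (g j) → i ≡ j
    c∘g-injective {zero}  {zero}  _  = refl
    c∘g-injective {i}     {suc j} eq = g-injective (own-colour (support-satisfies j) eq)
    c∘g-injective {suc i} {zero}  eq = g-injective (sym (own-colour (support-satisfies i) (sym eq)))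

  module LeafOrSupport (connected : Connected G) (order≥3 : n ≥ 3)
                       (leaf-or-support : ∀ v → Leaf v ⊎ Support v) where

    no-adjacent-leaves : ∀ {u v} → Leaf u → Leaf v → ¬ Adj G u v
    no-adjacent-leaves leaf-u leaf-v uv =
      <⇒≱ order≥3 (covered-by-two⇒≤2 (λ w → adjacent-leaves-span leaf-u leaf-v uv (connected _ w)))

    a-leaf : ∃ Leaf
    a-leaf with leaf-or-support (fromℕ< order≥3)
    ... | inj₁ leaf    = _ , leaf
    ... | inj₂ support = let (ℓ , _ , leaf) = support⇒leaf-neighbour support in ℓ , leaf

    colour : Fin n → Fin (suc (length supports))
    colour v with T? (isSupport G v)
    ... | yes support = suc (rank support)
    ... | no  _       = zero

    colour-support : ∀ {v} (support : Support v) → colour v ≡ suc (rank support)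
    colour-support {v} support with T? (isSupport G v)
    ... | yes support′ = cong (suc ∘ rank) (T-irrelevant support′ support)
    ... | no  ¬support = contradiction support ¬support

    colour-leaf : ∀ {v} → Leaf v → colour v ≡ zero
    colour-leaf {v} leaf with T? (isSupport G v)
    ... | yes support = contradiction support (leaf⇒¬support leaf)
    ... | no  _       = refl

    colour≡zero⇒leaf : ∀ {v} → colour v ≡ zero → Leaf v
    colour≡zero⇒leaf {v} eq with leaf-or-support v
    ... | inj₁ leaf    = leaf
    ... | inj₂ support with () ← trans (sym (colour-support support)) eq

    support-colour-unique : ∀ {u y} → Support u → colour y ≡ colour u → y ≡ u
    support-colour-unique {u} {y} support-u eq with leaf-or-support y
    ... | inj₁ leaf-y with () ← trans (sym (colour-leaf leaf-y)) (trans eq (colour-support support-u))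
    ... | inj₂ support-y = rank-injective support-y support-u
      (suc-injective (trans (sym (colour-support support-y)) (trans eq (colour-support support-u))))

    colour-proper : Proper G colour
    colour-proper u v uv eq with leaf-or-support u
    ... | inj₁ leaf-u    =
      no-adjacent-leaves leaf-u (colour≡zero⇒leaf (trans (sym eq) (colour-leaf leaf-u))) uv
    ... | inj₂ support-u = Adj-irrefl (subst (Adj G u) (support-colour-unique support-u (sym eq)) uv)

    Dominates : Fin n → Fin (suc (length supports)) → Set
    Dominates v i = (∃ λ x → colour x ≡ i) × (∀ u → colour u ≡ i → Adj G v u)

    support-neighbour-dominates : ∀ {v u} → Adj G v u → Support u → Dominates v (colour u)
    support-neighbour-dominates {v} {u} vu support =
      (u , refl) , λ y eq → subst (Adj G v) (sym (support-colour-unique support eq)) vu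

    colour-dominating : TotallyDominating G colour
    colour-dominating v with leaf-or-support v
    ... | inj₁ leaf-v =
      let (u , vu) = leaf-neighbour leaf-v in
      colour u , support-neighbour-dominates vu (neighbour-support u vu)
      where
      neighbour-support : ∀ u → Adj G v u → Support u
      neighbour-support u vu with leaf-or-support u
      ... | inj₁ leaf-u    = contradiction vu (no-adjacent-leaves leaf-v leaf-u)
      ... | inj₂ support-u = support-u
    ... | inj₂ support-v with any? (λ u → T? (adj v u) ×-dec T? (isSupport G u))
    ...   | yes (u , vu , support-u) = colour u , support-neighbour-dominates vu support-u
    ...   | no  no-support-neighbour =
      let (ℓ , _ , leaf) = support⇒leaf-neighbour support-v in
      zero , (ℓ , colour-leaf leaf) , λ y eq →
        [ (λ y≡v → contradiction support-v (leaf⇒¬support (subst Leaf y≡v (colour≡zero⇒leaf eq)))) , id ]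
          (leaf-neighbourhood-span neighbours-leaves (connected v y))
      where
      neighbours-leaves : ∀ {z} → Adj G v z → Leaf z
      neighbours-leaves {z} vz with leaf-or-support z
      ... | inj₁ leaf-z    = leaf-z
      ... | inj₂ support-z = contradiction (z , vz , support-z) no-support-neighbour

    HasTDC-1+numSupport : HasTDC G (suc (numSupport G))
    HasTDC-1+numSupport = subst (HasTDC G ∘ suc) (sym numSupport≡length-supports)
      (colour , colour-proper , colour-dominating)

proposition6p3 : (n : ℕ) → n ≥ 3 → (G : Graph n) → IsTree G →
    (∀ v → T (isLeaf G v) ⊎ T (isSupport G v)) →
    TDChromaticNumber≡ G (suc (numSupport G))
proposition6p3 n order≥3 G (connected , _) leaf-or-support =
  HasTDC-1+numSupport , λ k k<1+s tdc → <⇒≱ k<1+s (1+numSupport≤colours G (proj₂ a-leaf) tdc)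
  where open LeafOrSupport G connected order≥3 leaf-or-support
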